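{- For every positive integer $n$, $$T(n, \mathbb{N}\setminus\{1\})=\frac{n!}{2^{\lfloor n/2\rfloor}}.$$
   Context: Here $\mathbb{N}=\{1,2,3,\dots\}$ and $[n]=\{1,\dots,n\}$. For $D\subseteq\mathbb{N}$, two permutations $\pi,\sigma$ of $[n]$ are called $G(D)$-different if there is a position $i\in[n]$ with $|\pi(i)-\sigma(i)|\in D$. $T(n,D)$ denotes the maximum cardinality of a set of permutations of $[n]$ any two distinct members of which are $G(D)$-different. (Equivalently, $G(D)$ is the graph on $\mathbb{N}$ with edges $\{i,i+d\}$, $i\in\mathbb{N}$, $d\in D$, and two permutations are $G(D)$-different if they map some $i$ to adjacent vertices.) -}

module Defs where

open import Data.Nat using (ℕ; _≤_; _*_; _^_; _/_; ∣_-_∣; _!)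
open import Data.Fin using (Fin; toℕ)
open import Data.Fin.Permutation using (Permutation′; _⟨$⟩ʳ_)
open import Data.Product using (Σ; ∃; _×_)
open import Relation.Binary.PropositionalEquality using (_≡_; _≢_)
open import Data.Nat.Properties using (m^n≢0)

-- Permutations of [n] are modelled as bijections Fin n ↔ Fin n
-- (element k of Fin n stands for k+1 ∈ [n]; differences are unaffected).

GDifferent : (D : ℕ → Set) {n : ℕ} → Permutation′ n → Permutation′ n → Set
GDifferent D {n} π σ = ∃ λ (i : Fin n) → D ∣ toℕ (π ⟨$⟩ʳ i) - toℕ (σ ⟨$⟩ʳ i) ∣

-- Distinct indices must give G(D)-different (hence distinct) permutations,
-- so the family is a set of exactly m permutations.
PairwiseGDifferent : (D : ℕ → Set) {n m : ℕ} → (Fin m → Permutation′ n) → Set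
PairwiseGDifferent D F = ∀ a b → a ≢ b → GDifferent D (F a) (F b)

IsT : (n : ℕ) (D : ℕ → Set) (N : ℕ) → Set
IsT n D N =
  (Σ (Fin N → Permutation′ n) λ F → PairwiseGDifferent D F)
  × (∀ (m : ℕ) (F : Fin m → Permutation′ n) → PairwiseGDifferent D F → m ≤ N)

-- The set ℕ ∖ {1}, with ℕ = {1,2,3,...}.
NotOne : ℕ → Set
NotOne d = (1 ≤ d) × (d ≢ 1)

-- The value n! / 2^⌊n/2⌋ (ℕ division; ⌊n/2⌋ is n / 2).  The divisor is
-- nonzero; 2^⌊n/2⌋ divides n!, so this division is exact.
target : ℕ → ℕ
target n = _/_ (n !) (2 ^ (n / 2)) {{m^n≢0 2 (n / 2)}}

module Submission where

-- Two permutations fail to be G(ℕ∖{1})-different exactly when they are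
-- close: their values differ by at most one at every position.  A permutation π of [n+2] peels to a
-- permutation ρ of [n] at positions lo < hi when π takes the values {0,1}
-- at lo and hi and the values 2 + ρ, in order, at the other positions.
-- Permutations peeling at the same pair are close if the peeled ones are,
-- and G(D)-differences of the peeled ones lift.  Iterating the choice of a
-- pair gives codes; Code n has classCount n = ∏ C(n−2i, 2) elements, and
-- classCount n · 2^⌊n/2⌋ = n!.
--   * Upper bound: peeling every permutation at the positions of its values
--     0 and 1 gives a code map; equal codes force closeness, so pairwise
--     different permutations have distinct codes (pigeonhole).
--   * Lower bound: decoding a code, 0 and 1 are placed so that the
--     positions of 0, 1, 2 are in cyclic order.  Close "oriented"
--     permutations carry {0,1} at the same pair of positions, so distinct
--     codes decode to pairwise different permutations.

open import Defs
open import Data.Nat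
  using (ℕ; zero; suc; _+_; _*_; _^_; _/_; _!; _≤_; _<_; z≤n; s≤s; s≤s⁻¹; ∣_-_∣; _≟_; _≤?_; _<?_)
open import Data.Nat.Properties
open import Data.Nat.DivMod using (m*n/n≡m; m/n≡1+[m∸n]/n)
open import Data.Nat.Solver using (module +-*-Solver)
open import Data.Fin using (Fin; zero; suc; toℕ; fromℕ; fromℕ<; inject₁; punchIn; punchOut)
import Data.Fin.Properties as FP
open import Data.Fin.Permutation
  using (Permutation′; _⟨$⟩ʳ_; _⟨$⟩ˡ_; inverseˡ; inverseʳ; id; remove; insert; punchIn-permute; insert-punchIn)
open import Data.Sum using (_⊎_; inj₁; inj₂; [_,_]′)
open import Data.Product using (Σ; ∃; _×_; _,_; proj₁; proj₂)
open import Data.Unit using (⊤; tt)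
open import Data.Empty using (⊥; ⊥-elim)
open import Relation.Nullary using (¬_; Dec; yes; no)
open import Relation.Nullary.Decidable using (_×-dec_)
open import Relation.Binary.Definitions using (tri<; tri≈; tri>)
open import Relation.Binary.PropositionalEquality
open import Function using (_∘_)
open import Function.Bundles using (Inverse; Injection; _↔_)
open import Function.Properties.Inverse using (↔-refl; ↔-sym; ↔-trans; Inverse⇒Injection)
open import Data.Sum.Function.Propositional using (_⊎-↔_)
open import Data.Product.Function.NonDependent.Propositional using (_×-↔_)

-- triangle k = 1 + 2 + ⋯ + k, the number of pairs of positions in [k+1].
triangle : ℕ → ℕ
triangle zero    = zero
triangle (suc k) = triangle k + suc k

-- classCount n = ∏ C(n − 2i, 2): the number of codes (iterated pair choices).
classCount : ℕ → ℕ
classCount zero          = 1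
classCount (suc zero)    = 1
classCount (suc (suc n)) = triangle (suc n) * classCount n

triangle-double : ∀ k → triangle k * 2 ≡ k * suc k
triangle-double zero    = refl
triangle-double (suc k) = begin
    (triangle k + suc k) * 2     ≡⟨ *-distribʳ-+ 2 (triangle k) (suc k) ⟩
    triangle k * 2 + suc k * 2   ≡⟨ cong (_+ suc k * 2) (triangle-double k) ⟩
    k * suc k + suc k * 2        ≡⟨ solve 1 (λ k → k :* (con 1 :+ k) :+ (con 1 :+ k) :* con 2
                                                  := (con 1 :+ k) :* (con 2 :+ k)) refl k ⟩
    suc k * suc (suc k)          ∎
  where open ≡-Reasoning
        open +-*-Solver

half-suc-suc : ∀ n → suc (suc n) / 2 ≡ suc (n / 2)
half-suc-suc n = m/n≡1+[m∸n]/n {suc (suc n)} {2} (s≤s (s≤s z≤n))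

classCount-factorial : ∀ n → classCount n * 2 ^ (n / 2) ≡ n !
classCount-factorial zero          = refl
classCount-factorial (suc zero)    = refl
classCount-factorial (suc (suc n)) = begin
    t * c * 2 ^ (suc (suc n) / 2)   ≡⟨ cong (λ e → t * c * 2 ^ e) (half-suc-suc n) ⟩
    t * c * (2 * 2 ^ (n / 2))       ≡⟨ solve 3 (λ a b e → a :* b :* (con 2 :* e) := (a :* con 2) :* (b :* e))
                                             refl t c (2 ^ (n / 2)) ⟩
    (t * 2) * (c * 2 ^ (n / 2))     ≡⟨ cong₂ _*_ (triangle-double (suc n)) (classCount-factorial n) ⟩
    suc n * suc (suc n) * n !       ≡⟨ solve 3 (λ a b f → a :* b :* f := b :* (a :* f)) refl (suc n) (suc (suc n)) (n !) ⟩
    suc (suc n) !                   ∎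
  where open ≡-Reasoning
        open +-*-Solver
        t = triangle (suc n)
        c = classCount n

target≡classCount : ∀ n → target n ≡ classCount n
target≡classCount n = begin
    target n                                              ≡⟨ cong (λ x → _/_ x (2 ^ (n / 2)) {{nz}})
                                                                  (sym (classCount-factorial n)) ⟩
    _/_ (classCount n * 2 ^ (n / 2)) (2 ^ (n / 2)) {{nz}} ≡⟨ m*n/n≡m (classCount n) (2 ^ (n / 2)) {{nz}} ⟩
    classCount n                                          ∎
  where open ≡-Reasoning
        nz = m^n≢0 2 (n / 2)

-- Pair k: pairs of positions l < q + 1 in Fin (suc k), i.e. l ≤ q < k;
-- either q < k − 1 (left summand) or q = k − 1 and l ≤ k − 1 is free.
Pair : ℕ → Set
Pair zero    = ⊥
Pair (suc k) = Pair k ⊎ Fin (suc k)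

-- A code for a permutation of [n]: the pair of positions carrying the two
-- smallest values, followed by a code for the rest.
Code : ℕ → Set
Code zero          = ⊤
Code (suc zero)    = ⊤
Code (suc (suc n)) = Pair (suc n) × Code n

pair↔Fin : ∀ k → Pair k ↔ Fin (triangle k)
pair↔Fin zero    = ↔-sym FP.0↔⊥
pair↔Fin (suc k) = ↔-trans (pair↔Fin k ⊎-↔ ↔-refl) (↔-sym FP.+↔⊎)

code↔Fin : ∀ n → Code n ↔ Fin (classCount n)
code↔Fin zero          = ↔-sym FP.1↔⊤
code↔Fin (suc zero)    = ↔-sym FP.1↔⊤
code↔Fin (suc (suc n)) = ↔-trans (pair↔Fin (suc n) ×-↔ code↔Fin n) (↔-sym FP.*↔×)

pairOf : ∀ k (l q : ℕ) → l ≤ q → q < k → Pair k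
pairOf (suc k) l q l≤q q<k with q ≟ k
... | yes refl = inj₂ (fromℕ< (s≤s l≤q))
... | no q≢k   = inj₁ (pairOf k l q l≤q (≤∧≢⇒< (s≤s⁻¹ q<k) q≢k))

-- Decoding a pair: its lower position and q, with the upper position
-- being punchIn (lowPos p) (highIdx p) = 1 + q.
lowPos : ∀ {k} → Pair k → Fin (suc k)
lowPos {suc k} (inj₁ p) = inject₁ (lowPos p)
lowPos {suc k} (inj₂ l) = inject₁ l

highIdx : ∀ {k} → Pair k → Fin k
highIdx {suc k} (inj₁ p) = inject₁ (highIdx p)
highIdx {suc k} (inj₂ l) = fromℕ k

lowPos≤highIdx : ∀ {k} (p : Pair k) → toℕ (lowPos p) ≤ toℕ (highIdx p)
lowPos≤highIdx {suc k} (inj₁ p) = subst₂ _≤_ (sym (FP.toℕ-inject₁ _)) (sym (FP.toℕ-inject₁ _)) (lowPos≤highIdx p)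
lowPos≤highIdx {suc k} (inj₂ l) = subst₂ _≤_ (sym (FP.toℕ-inject₁ l)) (sym (FP.toℕ-fromℕ k)) (FP.toℕ≤pred[n] l)

decode-pairOf : ∀ k l q l≤q q<k →
                toℕ (lowPos (pairOf k l q l≤q q<k)) ≡ l × toℕ (highIdx (pairOf k l q l≤q q<k)) ≡ q
decode-pairOf (suc k) l q l≤q q<k with q ≟ k
... | yes refl = trans (FP.toℕ-inject₁ _) (FP.toℕ-fromℕ< _) , FP.toℕ-fromℕ k
... | no q≢k   with decode-pairOf k l q l≤q (≤∧≢⇒< (s≤s⁻¹ q<k) q≢k)
...   | el , eq = trans (FP.toℕ-inject₁ _) el , trans (FP.toℕ-inject₁ _) eq

pairOf-injective : ∀ k {l q l≤q q<k l′ q′ l′≤q′ q′<k} →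
                   pairOf k l q l≤q q<k ≡ pairOf k l′ q′ l′≤q′ q′<k → l ≡ l′ × q ≡ q′
pairOf-injective k {l} {q} {l≤q} {q<k} {l′} {q′} {l′≤q′} {q′<k} e =
  trans (sym (proj₁ d)) (trans (cong (toℕ ∘ lowPos) e) (proj₁ d′)) ,
  trans (sym (proj₂ d)) (trans (cong (toℕ ∘ highIdx) e) (proj₂ d′))
  where d  = decode-pairOf k l q l≤q q<k
        d′ = decode-pairOf k l′ q′ l′≤q′ q′<k

pair-injective : ∀ {k} (p p′ : Pair k) → lowPos p ≡ lowPos p′ → highIdx p ≡ highIdx p′ → p ≡ p′
pair-injective {suc k} (inj₁ p) (inj₁ p′) el eh =
  cong inj₁ (pair-injective p p′ (FP.inject₁-injective el) (FP.inject₁-injective eh))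
pair-injective {suc k} (inj₂ l) (inj₂ l′) el eh = cong inj₂ (FP.inject₁-injective el)
pair-injective {suc k} (inj₁ p) (inj₂ l′) el eh = ⊥-elim (FP.fromℕ≢inject₁ (sym eh))
pair-injective {suc k} (inj₂ l) (inj₁ p′) el eh = ⊥-elim (FP.fromℕ≢inject₁ eh)

Close : ∀ {n} → Permutation′ n → Permutation′ n → Set
Close π σ = ∀ i → ∣ toℕ (π ⟨$⟩ʳ i) - toℕ (σ ⟨$⟩ʳ i) ∣ ≤ 1

close-sym : ∀ {n} (π σ : Permutation′ n) → Close π σ → Close σ π
close-sym π σ cl i = subst (_≤ 1) (∣-∣-comm (toℕ (π ⟨$⟩ʳ i)) _) (cl i)

close⇒¬different : ∀ {n} {π σ : Permutation′ n} → Close π σ → ¬ GDifferent NotOne π σ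
close⇒¬different cl (i , 1≤d , d≢1) = d≢1 (≤-antisym (cl i) 1≤d)

different-or-close : ∀ {n} (π σ : Permutation′ n) → GDifferent NotOne π σ ⊎ Close π σ
different-or-close {n} π σ with FP.all? (λ i → ∣ toℕ (π ⟨$⟩ʳ i) - toℕ (σ ⟨$⟩ʳ i) ∣ ≤? 1)
... | yes cl = inj₂ cl
... | no ¬cl with FP.¬∀⟶∃¬ n _ (λ i → _ ≤? 1) ¬cl
...   | i , d≰1 = inj₁ (i , <⇒≤ (≰⇒> d≰1) , >⇒≢ (≰⇒> d≰1))

punchIn-zero≤1 : ∀ {n} (f : Fin (suc (suc n))) → toℕ (punchIn f zero) ≤ 1
punchIn-zero≤1 zero    = s≤s z≤n
punchIn-zero≤1 (suc f) = z≤n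

punchIn-suc : ∀ {n} (f : Fin (suc (suc n))) (r : Fin n) → toℕ f ≤ 1 → toℕ (punchIn f (suc r)) ≡ 2 + toℕ r
punchIn-suc zero          r _ = refl
punchIn-suc (suc zero)    r _ = refl
punchIn-suc (suc (suc f)) r (s≤s ())

record Peels {n} (π : Permutation′ (suc (suc n))) (lo : Fin (suc (suc n))) (q : Fin (suc n))
             (ρ : Permutation′ n) : Set where
  field
    atLo    : toℕ (π ⟨$⟩ʳ lo) ≤ 1
    atHi    : toℕ (π ⟨$⟩ʳ punchIn lo q) ≤ 1
    shifted : ∀ z → toℕ (π ⟨$⟩ʳ punchIn lo (punchIn q z)) ≡ 2 + toℕ (ρ ⟨$⟩ʳ z)

position-cases : ∀ {n} (lo : Fin (suc (suc n))) (q : Fin (suc n)) x →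
                 x ≡ lo ⊎ x ≡ punchIn lo q ⊎ ∃ λ z → x ≡ punchIn lo (punchIn q z)
position-cases lo q x with lo FP.≟ x
... | yes lo≡x = inj₁ (sym lo≡x)
... | no lo≢x with q FP.≟ punchOut lo≢x
...   | yes e  = inj₂ (inj₁ (trans (sym (FP.punchIn-punchOut lo≢x)) (cong (punchIn lo) (sym e))))
...   | no q≢y = inj₂ (inj₂ (punchOut q≢y ,
                  trans (sym (FP.punchIn-punchOut lo≢x)) (cong (punchIn lo) (sym (FP.punchIn-punchOut q≢y)))))

≤1-close : ∀ {a b} → a ≤ 1 → b ≤ 1 → ∣ a - b ∣ ≤ 1
≤1-close {zero}     {b}        _ b≤1 = b≤1
≤1-close {suc zero} {zero}     _ _   = s≤s z≤n
≤1-close {suc zero} {suc zero} _ _   = z≤n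
≤1-close {suc zero} {suc (suc b)} _ (s≤s ())
≤1-close {suc (suc a)} (s≤s ())

peels-close : ∀ {n} {π σ : Permutation′ (suc (suc n))} {lo q ρ ρ′} →
              Peels π lo q ρ → Peels σ lo q ρ′ → Close ρ ρ′ → Close π σ
peels-close {lo = lo} {q} pπ pσ cl x with position-cases lo q x
... | inj₁ refl          = ≤1-close (Peels.atLo pπ) (Peels.atLo pσ)
... | inj₂ (inj₁ refl)   = ≤1-close (Peels.atHi pπ) (Peels.atHi pσ)
... | inj₂ (inj₂ (z , refl)) =
  subst₂ (λ a b → ∣ a - b ∣ ≤ 1) (sym (Peels.shifted pπ z)) (sym (Peels.shifted pσ z)) (cl z)

peels-different : ∀ {n} {D : ℕ → Set} {π σ : Permutation′ (suc (suc n))} {lo q ρ ρ′} →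
                  Peels π lo q ρ → Peels σ lo q ρ′ → GDifferent D ρ ρ′ → GDifferent D π σ
peels-different {D = D} {lo = lo} {q} pπ pσ (z , d) =
  punchIn lo (punchIn q z) ,
  subst₂ (λ a b → D ∣ a - b ∣) (sym (Peels.shifted pπ z)) (sym (Peels.shifted pσ z)) d

position-of : ∀ {n} (τ : Permutation′ n) {x v} → τ ⟨$⟩ʳ x ≡ v → x ≡ τ ⟨$⟩ˡ v
position-of τ {x} τx≡v = trans (sym (inverseˡ τ)) (cong (τ ⟨$⟩ˡ_) τx≡v)

value≤1 : ∀ {n} (τ : Permutation′ (suc (suc n))) x → toℕ (τ ⟨$⟩ʳ x) ≤ 1 →
          x ≡ τ ⟨$⟩ˡ zero ⊎ x ≡ τ ⟨$⟩ˡ suc zero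
value≤1 τ x h with τ ⟨$⟩ʳ x in e
... | zero       = inj₁ (position-of τ e)
... | suc zero   = inj₂ (position-of τ e)
value≤1 τ x (s≤s ()) | suc (suc _)

value≤2 : ∀ {n} (τ : Permutation′ (suc (suc (suc n)))) x → toℕ (τ ⟨$⟩ʳ x) ≤ 2 →
          x ≡ τ ⟨$⟩ˡ zero ⊎ x ≡ τ ⟨$⟩ˡ suc zero ⊎ x ≡ τ ⟨$⟩ˡ suc (suc zero)
value≤2 τ x h with τ ⟨$⟩ʳ x in e
... | zero           = inj₁ (position-of τ e)
... | suc zero       = inj₂ (inj₁ (position-of τ e))
... | suc (suc zero) = inj₂ (inj₂ (position-of τ e))
value≤2 τ x (s≤s (s≤s ())) | suc (suc (suc _))

punchIn-above : ∀ {n} (i : Fin (suc n)) (j : Fin n) → toℕ i < toℕ (punchIn i j) → toℕ i ≤ toℕ j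
punchIn-above zero    j       _       = z≤n
punchIn-above (suc i) zero    ()
punchIn-above (suc i) (suc j) (s≤s h) = s≤s (punchIn-above i j h)

earlier : ∀ {m} → Fin m → Fin m → Fin m
earlier a b with toℕ a ≤? toℕ b
... | yes _ = a
... | no _  = b

earlier≤ : ∀ {m} (a b x : Fin m) → x ≡ a ⊎ x ≡ b → toℕ (earlier a b) ≤ toℕ x
earlier≤ a b x x∈ab with toℕ a ≤? toℕ b | x∈ab
... | yes a≤b | inj₁ refl = ≤-refl
... | yes a≤b | inj₂ refl = a≤b
... | no a≰b  | inj₁ refl = <⇒≤ (≰⇒> a≰b)
... | no a≰b  | inj₂ refl = ≤-refl

earlier-sel : ∀ {m} (P : Fin m → Set) {a b : Fin m} → P a → P b → P (earlier a b)
earlier-sel P {a} {b} pa pb with toℕ a ≤? toℕ b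
... | yes _ = pa
... | no _  = pb

record Peeling {n} (π : Permutation′ (suc (suc n))) : Set where
  field
    lo    : Fin (suc (suc n))
    q     : Fin (suc n)
    rest  : Permutation′ n
    lo≤q  : toℕ lo ≤ toℕ q
    peels : Peels π lo q rest

peeling : ∀ {n} (π : Permutation′ (suc (suc n))) → Peeling π
peeling π = record { lo = lo ; q = q ; rest = rest ; lo≤q = lo≤q
                   ; peels = record { atLo = atLo ; atHi = atHi ; shifted = shifted } }
  where
  lo = earlier (π ⟨$⟩ˡ zero) (π ⟨$⟩ˡ suc zero)
  π′ = remove lo π
  q = π′ ⟨$⟩ˡ zero
  rest = remove q π′

  atLo : toℕ (π ⟨$⟩ʳ lo) ≤ 1
  atLo = earlier-sel (λ x → toℕ (π ⟨$⟩ʳ x) ≤ 1)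
           (subst (λ v → toℕ v ≤ 1) (sym (inverseʳ π)) z≤n)
           (subst (λ v → toℕ v ≤ 1) (sym (inverseʳ π)) (s≤s z≤n))

  -- Removing lo shifts the other small value down to 0, at position q.
  hiValue : π ⟨$⟩ʳ punchIn lo q ≡ punchIn (π ⟨$⟩ʳ lo) zero
  hiValue = trans (punchIn-permute π lo q) (cong (punchIn (π ⟨$⟩ʳ lo)) (inverseʳ π′))

  restValue : ∀ z → π ⟨$⟩ʳ punchIn lo (punchIn q z) ≡ punchIn (π ⟨$⟩ʳ lo) (suc (rest ⟨$⟩ʳ z))
  restValue z = begin
      π ⟨$⟩ʳ punchIn lo (punchIn q z)                         ≡⟨ punchIn-permute π lo (punchIn q z) ⟩
      punchIn (π ⟨$⟩ʳ lo) (π′ ⟨$⟩ʳ punchIn q z)               ≡⟨ cong (punchIn (π ⟨$⟩ʳ lo)) (punchIn-permute π′ q z) ⟩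
      punchIn (π ⟨$⟩ʳ lo) (punchIn (π′ ⟨$⟩ʳ q) (rest ⟨$⟩ʳ z)) ≡⟨ cong (λ v → punchIn (π ⟨$⟩ʳ lo) (punchIn v r)) (inverseʳ π′) ⟩
      punchIn (π ⟨$⟩ʳ lo) (suc (rest ⟨$⟩ʳ z))                 ∎
    where open ≡-Reasoning
          r = rest ⟨$⟩ʳ z

  atHi : toℕ (π ⟨$⟩ʳ punchIn lo q) ≤ 1
  atHi = subst (λ v → toℕ v ≤ 1) (sym hiValue) (punchIn-zero≤1 (π ⟨$⟩ʳ lo))

  shifted : ∀ z → toℕ (π ⟨$⟩ʳ punchIn lo (punchIn q z)) ≡ 2 + toℕ (rest ⟨$⟩ʳ z)
  shifted z = trans (cong toℕ (restValue z)) (punchIn-suc (π ⟨$⟩ʳ lo) (rest ⟨$⟩ʳ z) atLo)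

  -- lo is the earlier of the two positions of small values, one of which
  -- is punchIn lo q ≠ lo.
  lo≤q : toℕ lo ≤ toℕ q
  lo≤q = punchIn-above lo q
    (≤∧≢⇒< (earlier≤ _ _ _ (value≤1 π _ atHi)) (λ e → FP.punchInᵢ≢i lo q (sym (FP.toℕ-injective e))))

encode : ∀ n → Permutation′ n → Code n
encode zero          _ = tt
encode (suc zero)    _ = tt
encode (suc (suc n)) π = pairOf (suc n) (toℕ lo) (toℕ q) lo≤q (FP.toℕ<n q) , encode n rest
  where open Peeling (peeling π)

encode-close : ∀ n (π σ : Permutation′ n) → encode n π ≡ encode n σ → Close π σ
encode-close zero       π σ _ ()
encode-close (suc zero) π σ _ zero with π ⟨$⟩ʳ zero | σ ⟨$⟩ʳ zero
... | zero | zero = z≤n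
encode-close (suc (suc n)) π σ same =
  peels-close (peels P) (subst₂ (λ l r → Peels σ l r (rest S)) lo-same q-same (peels S))
              (encode-close n (rest P) (rest S) (cong proj₂ same))
  where
  open Peeling
  P = peeling π
  S = peeling σ
  ends = pairOf-injective (suc n) (cong proj₁ same)
  lo-same : lo S ≡ lo P
  lo-same = FP.toℕ-injective (sym (proj₁ ends))
  q-same : q S ≡ q P
  q-same = FP.toℕ-injective (sym (proj₂ ends))

upperBound : ∀ n m (F : Fin m → Permutation′ n) → PairwiseGDifferent NotOne F → m ≤ classCount n
upperBound n m F different with m ≤? classCount n
... | yes m≤count = m≤count
... | no m≰count with FP.pigeonhole (≰⇒> m≰count) (Inverse.to (code↔Fin n) ∘ encode n ∘ F)
...   | i , j , i<j , same-index =
  ⊥-elim (close⇒¬different {π = F i} {F j} (encode-close n (F i) (F j) same-code) (different i j (FP.<⇒≢ i<j)))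
  where same-code = Injection.injective (Inverse⇒Injection (code↔Fin n)) same-index

Cyc : ℕ → ℕ → ℕ → Set
Cyc x y z = (x < y × y < z) ⊎ (y < z × z < x) ⊎ (z < x × x < y)

cyc-reverse : ∀ {x y z} → Cyc x y z → ¬ Cyc x z y
cyc-reverse (inj₁ (x<y , y<z))         (inj₁ (x<z , z<y))         = <-asym y<z z<y
cyc-reverse (inj₁ (x<y , y<z))         (inj₂ (inj₁ (z<y , y<x)))  = <-asym x<y y<x
cyc-reverse (inj₁ (x<y , y<z))         (inj₂ (inj₂ (y<x , x<z)))  = <-asym x<y y<x
cyc-reverse (inj₂ (inj₁ (y<z , z<x)))  (inj₁ (x<z , z<y))         = <-asym y<z z<y
cyc-reverse (inj₂ (inj₁ (y<z , z<x)))  (inj₂ (inj₁ (z<y , y<x)))  = <-asym y<z z<y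
cyc-reverse (inj₂ (inj₁ (y<z , z<x)))  (inj₂ (inj₂ (y<x , x<z)))  = <-asym z<x x<z
cyc-reverse (inj₂ (inj₂ (z<x , x<y)))  (inj₁ (x<z , z<y))         = <-asym z<x x<z
cyc-reverse (inj₂ (inj₂ (z<x , x<y)))  (inj₂ (inj₁ (z<y , y<x)))  = <-asym x<y y<x
cyc-reverse (inj₂ (inj₂ (z<x , x<y)))  (inj₂ (inj₂ (y<x , x<z)))  = <-asym z<x x<z

cyc-transport : ∀ {x y z x′ y′ z′} → x ≡ x′ → y ≡ y′ → z ≡ z′ → Cyc x y z → Cyc x′ y′ z′
cyc-transport refl refl refl c = c

Oriented : ∀ {m} → Permutation′ (suc (suc (suc m))) → Set
Oriented σ = Cyc (toℕ (σ ⟨$⟩ˡ zero)) (toℕ (σ ⟨$⟩ˡ suc zero)) (toℕ (σ ⟨$⟩ˡ suc (suc zero)))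

SamePair : ∀ {N} → Fin N → Fin N → Fin N → Fin N → Set
SamePair a b c d = (a ≡ c × b ≡ d) ⊎ (a ≡ d × b ≡ c)

samePair-sym : ∀ {N} {a b c d : Fin N} → SamePair a b c d → SamePair c d a b
samePair-sym (inj₁ (refl , refl)) = inj₁ (refl , refl)
samePair-sym (inj₂ (refl , refl)) = inj₂ (refl , refl)

samePair-trans : ∀ {N} {a b c d e f : Fin N} → SamePair a b c d → SamePair c d e f → SamePair a b e f
samePair-trans (inj₁ (refl , refl)) s = s
samePair-trans (inj₂ (refl , refl)) (inj₁ (refl , refl)) = inj₂ (refl , refl)
samePair-trans (inj₂ (refl , refl)) (inj₂ (refl , refl)) = inj₁ (refl , refl)

samePair-members : ∀ {N} {a b c d : Fin N} → a ≡ c ⊎ a ≡ d → b ≡ c ⊎ b ≡ d → a ≢ b → SamePair a b c d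
samePair-members (inj₁ refl) (inj₁ refl) a≢b = ⊥-elim (a≢b refl)
samePair-members (inj₁ a≡c)  (inj₂ b≡d)  _   = inj₁ (a≡c , b≡d)
samePair-members (inj₂ a≡d)  (inj₁ b≡c)  _   = inj₂ (a≡d , b≡c)
samePair-members (inj₂ refl) (inj₂ refl) a≢b = ⊥-elim (a≢b refl)

samePair-ordered : ∀ {N} {a b c d : Fin N} → toℕ a < toℕ b → toℕ c < toℕ d → SamePair a b c d → a ≡ c × b ≡ d
samePair-ordered _   _   (inj₁ e)             = e
samePair-ordered a<b c<d (inj₂ (refl , refl)) = ⊥-elim (<-asym a<b c<d)

positions-distinct : ∀ {n} (σ : Permutation′ n) {u v} → u ≢ v → σ ⟨$⟩ˡ u ≢ σ ⟨$⟩ˡ v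
positions-distinct σ u≢v e = u≢v (trans (sym (inverseʳ σ)) (trans (cong (σ ⟨$⟩ʳ_) e) (inverseʳ σ)))

close-at-0 : ∀ {n} (σ τ : Permutation′ (suc n)) → Close σ τ → toℕ (τ ⟨$⟩ʳ (σ ⟨$⟩ˡ zero)) ≤ 1
close-at-0 σ τ cl = subst (λ v → ∣ toℕ v - toℕ (τ ⟨$⟩ʳ (σ ⟨$⟩ˡ zero)) ∣ ≤ 1) (inverseʳ σ) (cl _)

close-at-1 : ∀ {n} (σ τ : Permutation′ (suc (suc n))) → Close σ τ → toℕ (τ ⟨$⟩ʳ (σ ⟨$⟩ˡ suc zero)) ≤ 2
close-at-1 σ τ cl = near-1 (subst (λ v → ∣ toℕ v - toℕ (τ ⟨$⟩ʳ (σ ⟨$⟩ˡ suc zero)) ∣ ≤ 1) (inverseʳ σ) (cl _))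
  where
  near-1 : ∀ {b} → ∣ 1 - b ∣ ≤ 1 → b ≤ 2
  near-1 {zero}  _ = z≤n
  near-1 {suc b} h = s≤s h

-- Key lemma: close oriented permutations place 0 and 1 at the same pair
-- of positions.  Otherwise 1 of σ sits where τ has 2 and vice versa, and
-- the two orientations are reverse to each other.
oriented-close : ∀ {m} (σ τ : Permutation′ (suc (suc (suc m)))) → Oriented σ → Oriented τ → Close σ τ →
                 SamePair (σ ⟨$⟩ˡ zero) (σ ⟨$⟩ˡ suc zero) (τ ⟨$⟩ˡ zero) (τ ⟨$⟩ˡ suc zero)
oriented-close σ τ oσ oτ cl = from-a₁ (value≤2 τ a₁ (close-at-1 σ τ cl))
  where
  a₀ = σ ⟨$⟩ˡ zero
  a₁ = σ ⟨$⟩ˡ suc zero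
  a₂ = σ ⟨$⟩ˡ suc (suc zero)
  b₀ = τ ⟨$⟩ˡ zero
  b₁ = τ ⟨$⟩ˡ suc zero
  b₂ = τ ⟨$⟩ˡ suc (suc zero)

  a₀∈B : a₀ ≡ b₀ ⊎ a₀ ≡ b₁
  a₀∈B = value≤1 τ a₀ (close-at-0 σ τ cl)
  b₀∈A : b₀ ≡ a₀ ⊎ b₀ ≡ a₁
  b₀∈A = value≤1 σ b₀ (close-at-0 τ σ (close-sym σ τ cl))

  -- Case a₁ = b₂: then b₀ = a₀ and b₁ = a₂, contradicting orientation.
  from-b₁ : a₁ ≡ b₂ → b₁ ≡ a₀ ⊎ b₁ ≡ a₁ ⊎ b₁ ≡ a₂ → SamePair a₀ a₁ b₀ b₁
  from-b₁ _     (inj₁ b₁≡a₀)        = samePair-sym (samePair-members b₀∈A (inj₁ b₁≡a₀) (positions-distinct τ λ ()))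
  from-b₁ _     (inj₂ (inj₁ b₁≡a₁)) = samePair-sym (samePair-members b₀∈A (inj₂ b₁≡a₁) (positions-distinct τ λ ()))
  from-b₁ a₁≡b₂ (inj₂ (inj₂ b₁≡a₂)) with b₀∈A
  ... | inj₂ b₀≡a₁ = ⊥-elim (positions-distinct τ (λ ()) (trans b₀≡a₁ a₁≡b₂))
  ... | inj₁ b₀≡a₀ = ⊥-elim (cyc-reverse oτ
                       (cyc-transport (cong toℕ (sym b₀≡a₀)) (cong toℕ a₁≡b₂) (cong toℕ (sym b₁≡a₂)) oσ))

  from-a₁ : a₁ ≡ b₀ ⊎ a₁ ≡ b₁ ⊎ a₁ ≡ b₂ → SamePair a₀ a₁ b₀ b₁
  from-a₁ (inj₁ a₁≡b₀)        = samePair-members a₀∈B (inj₁ a₁≡b₀) (positions-distinct σ λ ())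
  from-a₁ (inj₂ (inj₁ a₁≡b₁)) = samePair-members a₀∈B (inj₂ a₁≡b₁) (positions-distinct σ λ ())
  from-a₁ (inj₂ (inj₂ a₁≡b₂)) = from-b₁ a₁≡b₂ (value≤2 σ b₁ (close-at-1 τ σ (close-sym σ τ cl)))

punchIn-≥ : ∀ {n} (i : Fin (suc n)) (j : Fin n) → toℕ i ≤ toℕ j → toℕ (punchIn i j) ≡ suc (toℕ j)
punchIn-≥ zero    j       _       = refl
punchIn-≥ (suc i) zero    ()
punchIn-≥ (suc i) (suc j) (s≤s h) = cong suc (punchIn-≥ i j h)

insert-at : ∀ {m n} (i : Fin (suc m)) (j : Fin (suc n)) π → insert i j π ⟨$⟩ʳ i ≡ j
insert-at i j π with i FP.≟ i
... | yes _  = refl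
... | no i≢i = ⊥-elim (i≢i refl)

-- place lo q f ρ takes the value f at lo, the other value of {0,1} at
-- punchIn lo q, and 2 + ρ elsewhere.
place : ∀ {n} → Fin (suc (suc n)) → Fin (suc n) → Fin (suc (suc n)) → Permutation′ n → Permutation′ (suc (suc n))
place lo q f ρ = insert lo f (insert q zero ρ)

place-hi : ∀ {n} lo q f (ρ : Permutation′ n) → place lo q f ρ ⟨$⟩ʳ punchIn lo q ≡ punchIn f zero
place-hi lo q f ρ = trans (insert-punchIn lo f _ q) (cong (punchIn f) (insert-at q zero ρ))

place-rest : ∀ {n} lo q f (ρ : Permutation′ n) z →
             place lo q f ρ ⟨$⟩ʳ punchIn lo (punchIn q z) ≡ punchIn f (suc (ρ ⟨$⟩ʳ z))
place-rest lo q f ρ z = trans (insert-punchIn lo f _ (punchIn q z)) (cong (punchIn f) (insert-punchIn q zero ρ z))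

place-peels : ∀ {n} lo q f (ρ : Permutation′ n) → toℕ f ≤ 1 → Peels (place lo q f ρ) lo q ρ
place-peels lo q f ρ f≤1 = record
  { atLo    = subst (λ v → toℕ v ≤ 1) (sym (insert-at lo f _)) f≤1
  ; atHi    = subst (λ v → toℕ v ≤ 1) (sym (place-hi lo q f ρ)) (punchIn-zero≤1 f)
  ; shifted = λ z → trans (cong toℕ (place-rest lo q f ρ z)) (punchIn-suc f (ρ ⟨$⟩ʳ z) f≤1)
  }

-- The oriented placement: put 1 at lo exactly when the position `two` of
-- the value 2 lies strictly between lo and hi = punchIn lo q.
module OrientedPlacement {m} (lo : Fin (suc (suc (suc m)))) (q : Fin (suc (suc m))) (ρ : Permutation′ (suc m)) where
  hi two : Fin (suc (suc (suc m)))
  hi  = punchIn lo q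
  two = punchIn lo (punchIn q (ρ ⟨$⟩ˡ zero))

  Between : Set
  Between = toℕ lo < toℕ two × toℕ two < toℕ hi

  between? : Dec Between
  between? = (toℕ lo <? toℕ two) ×-dec (toℕ two <? toℕ hi)

  orientedAt : Fin (suc (suc (suc m))) → Permutation′ (suc (suc (suc m)))
  orientedAt f = place lo q f ρ

  decodeStep : Permutation′ (suc (suc (suc m)))
  decodeStep with between?
  ... | yes _ = orientedAt (suc zero)
  ... | no _  = orientedAt zero

  two-position : ∀ f → toℕ f ≤ 1 → orientedAt f ⟨$⟩ˡ suc (suc zero) ≡ two
  two-position f f≤1 = sym (position-of (orientedAt f) (FP.toℕ-injective (begin
      toℕ (orientedAt f ⟨$⟩ʳ two)                  ≡⟨ cong toℕ (place-rest lo q f ρ _) ⟩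
      toℕ (punchIn f (suc (ρ ⟨$⟩ʳ (ρ ⟨$⟩ˡ zero)))) ≡⟨ punchIn-suc f _ f≤1 ⟩
      2 + toℕ (ρ ⟨$⟩ʳ (ρ ⟨$⟩ˡ zero))               ≡⟨ cong (λ v → 2 + toℕ v) (inverseʳ ρ) ⟩
      2                                            ∎)))
    where open ≡-Reasoning

  oriented-if : ∀ f {x y} → toℕ f ≤ 1 → orientedAt f ⟨$⟩ˡ zero ≡ x → orientedAt f ⟨$⟩ˡ suc zero ≡ y →
                Cyc (toℕ x) (toℕ y) (toℕ two) → Oriented (orientedAt f)
  oriented-if f f≤1 at-0 at-1 =
    cyc-transport (cong toℕ (sym at-0)) (cong toℕ (sym at-1)) (cong toℕ (sym (two-position f f≤1)))

  two≢lo : toℕ two ≢ toℕ lo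
  two≢lo e = FP.punchInᵢ≢i lo _ (FP.toℕ-injective e)

  two≢hi : toℕ two ≢ toℕ hi
  two≢hi e = FP.punchInᵢ≢i q _ (FP.punchIn-injective lo _ _ (FP.toℕ-injective e))

  outside-cyc : toℕ lo < toℕ hi → ¬ Between → Cyc (toℕ lo) (toℕ hi) (toℕ two)
  outside-cyc lo<hi ¬between with <-cmp (toℕ lo) (toℕ two)
  ... | tri≈ _ lo≡two _ = ⊥-elim (two≢lo (sym lo≡two))
  ... | tri> _ _ two<lo = inj₂ (inj₂ (two<lo , lo<hi))
  ... | tri< lo<two _ _ = inj₁ (lo<hi , ≤∧≢⇒< (≮⇒≥ (λ two<hi → ¬between (lo<two , two<hi))) (≢-sym two≢hi))

  decodeStep-peels : Peels decodeStep lo q ρ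
  decodeStep-peels with between?
  ... | yes _ = place-peels lo q (suc zero) ρ (s≤s z≤n)
  ... | no _  = place-peels lo q zero ρ z≤n

  decodeStep-shape : toℕ lo < toℕ hi →
                     SamePair (decodeStep ⟨$⟩ˡ zero) (decodeStep ⟨$⟩ˡ suc zero) lo hi × Oriented decodeStep
  decodeStep-shape lo<hi with between?
  ... | yes between = inj₂ (at-0 , at-1) , oriented-if (suc zero) (s≤s z≤n) at-0 at-1 (inj₂ (inj₁ between))
    where
    at-0 : orientedAt (suc zero) ⟨$⟩ˡ zero ≡ hi
    at-0 = sym (position-of (orientedAt (suc zero)) (place-hi lo q (suc zero) ρ))
    at-1 : orientedAt (suc zero) ⟨$⟩ˡ suc zero ≡ lo
    at-1 = sym (position-of (orientedAt (suc zero)) (insert-at lo (suc zero) _))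
  ... | no ¬between = inj₁ (at-0 , at-1) , oriented-if zero z≤n at-0 at-1 (outside-cyc lo<hi ¬between)
    where
    at-0 : orientedAt zero ⟨$⟩ˡ zero ≡ lo
    at-0 = sym (position-of (orientedAt zero) (insert-at lo zero _))
    at-1 : orientedAt zero ⟨$⟩ˡ suc zero ≡ hi
    at-1 = sym (position-of (orientedAt zero) (place-hi lo q zero ρ))

decodePair : ∀ {m} → Pair (suc (suc m)) → Permutation′ (suc m) → Permutation′ (suc (suc (suc m)))
decodePair p ρ = OrientedPlacement.decodeStep (lowPos p) (highIdx p) ρ

-- Decoding a code, recursively (for n ≤ 2 there is a single code).
decode : ∀ n → Code n → Permutation′ n
decode zero                _       = id
decode (suc zero)          _       = id
decode (suc (suc zero))    _       = id
decode (suc (suc (suc m))) (p , κ) = decodePair p (decode (suc m) κ)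

pair-ordered : ∀ {k} (p : Pair (suc k)) → toℕ (lowPos p) < toℕ (punchIn (lowPos p) (highIdx p))
pair-ordered p = subst (toℕ (lowPos p) <_) (sym (punchIn-≥ (lowPos p) (highIdx p) (lowPos≤highIdx p)))
                       (s≤s (lowPos≤highIdx p))

decodePair-close : ∀ {m} (p p′ : Pair (suc (suc m))) ρ ρ′ → Close (decodePair p ρ) (decodePair p′ ρ′) → p ≡ p′
decodePair-close p p′ ρ ρ′ cl = pair-injective p p′ lo-same q-same
  where
  module S  = OrientedPlacement (lowPos p) (highIdx p) ρ
  module S′ = OrientedPlacement (lowPos p′) (highIdx p′) ρ′
  shape  = S.decodeStep-shape (pair-ordered p)
  shape′ = S′.decodeStep-shape (pair-ordered p′)
  ends : lowPos p ≡ lowPos p′ × S.hi ≡ S′.hi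
  ends = samePair-ordered (pair-ordered p) (pair-ordered p′)
           (samePair-trans (samePair-sym (proj₁ shape))
             (samePair-trans (oriented-close S.decodeStep S′.decodeStep (proj₂ shape) (proj₂ shape′) cl)
               (proj₁ shape′)))
  lo-same = proj₁ ends
  q-same : highIdx p ≡ highIdx p′
  q-same = FP.punchIn-injective (lowPos p) _ _ (trans (proj₂ ends) (cong (λ l → punchIn l (highIdx p′)) (sym lo-same)))

decodePair-different : ∀ {m} {D : ℕ → Set} (p : Pair (suc (suc m))) ρ ρ′ →
                       GDifferent D ρ ρ′ → GDifferent D (decodePair p ρ) (decodePair p ρ′)
decodePair-different {D = D} p ρ ρ′ =
  peels-different {D = D} (OrientedPlacement.decodeStep-peels (lowPos p) (highIdx p) ρ)
                  (OrientedPlacement.decodeStep-peels (lowPos p) (highIdx p) ρ′)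

-- Distinct codes decode to G(ℕ∖{1})-different permutations: either the
-- decoded permutations are already not close, or their pairs agree and the
-- rests differ.
decode-different : ∀ n (κ κ′ : Code n) → κ ≢ κ′ → GDifferent NotOne (decode n κ) (decode n κ′)
decode-different zero                tt               tt               κ≢κ′ = ⊥-elim (κ≢κ′ refl)
decode-different (suc zero)          tt               tt               κ≢κ′ = ⊥-elim (κ≢κ′ refl)
decode-different (suc (suc zero))    (inj₂ zero , tt) (inj₂ zero , tt) κ≢κ′ = ⊥-elim (κ≢κ′ refl)
decode-different (suc (suc (suc m))) (p , κ) (p′ , κ′) κ≢κ′ =
  [ (λ different → different) , from-close (decode-different (suc m) κ κ′) ]′ (different-or-close σ σ′)
  where
  σ  = decodePair p (decode (suc m) κ)
  σ′ = decodePair p′ (decode (suc m) κ′)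
  from-close : (κ ≢ κ′ → GDifferent NotOne (decode (suc m) κ) (decode (suc m) κ′)) →
               Close σ σ′ → GDifferent NotOne σ σ′
  from-close rests-different close =
    subst (λ p″ → GDifferent NotOne σ (decodePair p″ (decode (suc m) κ′))) same-pair
          (decodePair-different {D = NotOne} p _ _ (rests-different (κ≢κ′ ∘ cong₂ _,_ same-pair)))
    where same-pair = decodePair-close p p′ _ _ close

lowerBound : ∀ n → Σ (Fin (classCount n) → Permutation′ n) (PairwiseGDifferent NotOne)
lowerBound n = decode n ∘ Inverse.from (code↔Fin n) ,
               λ a b a≢b → decode-different n _ _ (a≢b ∘ Injection.injective (Inverse⇒Injection (↔-sym (code↔Fin n))))

-- T(n, ℕ ∖ {1}) = classCount n = n! / 2^⌊n/2⌋ (for every n, in fact).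
theorem1 : (n : ℕ) → 1 ≤ n → IsT n NotOne (target n)
theorem1 n _ = subst (IsT n NotOne) (sym (target≡classCount n)) (lowerBound n , upperBound n)
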